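{- Let $N=(\Gamma,B)$ be a network with $|B|=2$. Then $M(N)\cong M(\hat\Gamma)$, the graphic matroid of the graph $\hat\Gamma$ obtained from $\Gamma$ by adding an edge between the two boundary nodes; in particular $M(N)$ is graphic.
   Context: A network $N=(\Gamma,B)$ consists of a finite connected graph $\Gamma=(V,E)$ with no loops or multiple edges and a set $B\subsetneq V$ of at least 2 vertices (boundary nodes), no two of which are adjacent; vertices in $V\setminus B$ are interior. The Dirichlet matroid $M(N)$: fix an injective $u:B\to\mathbb{R}$ and a new symbol $e_0\notin E$; in $\mathbb{R}^{(V\setminus B)\cup\{0\}}$ assign to each edge $ij$ with $i,j$ interior the vector $\mathbf{e}_i-\mathbf{e}_j$, to each edge $ij$ with $i$ interior and $j\in B$ the vector $\mathbf{e}_i-u(j)\mathbf{e}_0$, and to $e_0$ the vector $\mathbf{e}_0$; $M(N)$ is the matroid of linear independence of these vectors on $E\cup\{e_0\}$ (independent of the choice of injective $u$).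
   Formalization: The injective boundary function u takes rational values, and linear independence of the vectors defining M(N) is taken over ℚ rather than ℝ. -}

module Defs where

open import Data.Nat using (ℕ; zero; suc)
open import Data.Fin using (Fin; zero; suc; inject₁; fromℕ; _≟_)
open import Data.Fin.Subset using (Subset; _∈_; _∉_; ∣_∣)
open import Data.Fin.Subset.Properties using (_∈?_)
open import Data.Product using (_×_; _,_; proj₁; proj₂; Σ; ∃; ∃-syntax)
open import Data.Sum using (_⊎_)
open import Data.Rational using (ℚ; 0ℚ; 1ℚ; _+_; _*_; _-_)
open import Data.Vec using (tabulate; lookup)
open import Relation.Binary.PropositionalEquality using (_≡_; _≢_)
open import Relation.Nullary using (¬_; yes; no)
open import Function.Definitions using (Injective)
open import Function.Bundles using (_↔_; Inverse)

-- Finite (multi)graphs: vertices Fin n, edges Fin m, each edge has an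
-- ordered pair of endpoints (orientation irrelevant everywhere below).

Ends : ℕ → ℕ → Set
Ends n m = Fin m → Fin n × Fin n

Joins : {n m : ℕ} → Ends n m → Fin m → Fin n → Fin n → Set
Joins ends e a b = (ends e ≡ (a , b)) ⊎ (ends e ≡ (b , a))

Adjacent : {n m : ℕ} → Ends n m → Fin n → Fin n → Set
Adjacent ends a b = ∃[ e ] Joins ends e a b

record Walk {n m : ℕ} (ends : Ends n m) (a b : Fin n) : Set where
  field
    len   : ℕ
    verts : Fin (suc len) → Fin n
    start : verts zero ≡ a
    stop  : verts (fromℕ len) ≡ b
    steps : (j : Fin len) → Adjacent ends (verts (inject₁ j)) (verts (suc j))

NoLoops : {n m : ℕ} → Ends n m → Set
NoLoops ends = ∀ e → proj₁ (ends e) ≢ proj₂ (ends e)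

NoMultiEdges : {n m : ℕ} → Ends n m → Set
NoMultiEdges ends = ∀ e f a b → Joins ends e a b → Joins ends f a b → e ≡ f

Connected : {n m : ℕ} → Ends n m → Set
Connected ends = ∀ a b → Walk ends a b

record IsSimpleConnected {n m : ℕ} (ends : Ends n m) : Set where
  field
    noLoops   : NoLoops ends
    noMulti   : NoMultiEdges ends
    connected : Connected ends

record IsNetwork {n m : ℕ} (ends : Ends n m) (B : Subset n) : Set where
  field
    graph         : IsSimpleConnected ends
    properSubset  : ∃[ v ] v ∉ B
    atLeastTwo    : ∃[ a ] ∃[ b ] (a ≢ b × a ∈ B × b ∈ B)
    nonAdjacentB  : ∀ e → ¬ (proj₁ (ends e) ∈ B × proj₂ (ends e) ∈ B)

Σℚ : (k : ℕ) → (Fin k → ℚ) → ℚ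
Σℚ zero    f = 0ℚ
Σℚ (suc k) f = f zero + Σℚ k (λ i → f (suc i))

LinIndep : {k d : ℕ} → (Fin k → Fin d → ℚ) → Subset k → Set
LinIndep {k} v S =
  (c : Fin k → ℚ) →
  (∀ i → i ∉ S → c i ≡ 0ℚ) →
  (∀ x → Σℚ k (λ i → c i * v i x) ≡ 0ℚ) →
  ∀ i → c i ≡ 0ℚ

basis : {d : ℕ} → Fin d → Fin d → ℚ
basis i x with i ≟ x
... | yes _ = 1ℚ
... | no  _ = 0ℚ

-- Coordinates: Fin (suc n); coordinate `zero` is the
-- extra coordinate 0, coordinate `suc v` belongs to vertex v (the
-- coordinates of boundary vertices are never used, i.e. always 0).
-- Ground set Fin (suc m): `zero` is e₀, `suc e` is the edge e.

e₀vec : {n : ℕ} → Fin (suc n) → ℚ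
e₀vec = basis zero

vtx : {n : ℕ} → Fin n → Fin (suc n) → ℚ
vtx v = basis (suc v)

_·_ : {d : ℕ} → ℚ → (Fin d → ℚ) → Fin d → ℚ
(a · w) x = a * w x

_⊖_ : {d : ℕ} → (Fin d → ℚ) → (Fin d → ℚ) → Fin d → ℚ
(w ⊖ w') x = w x - w' x

edgeVec : {n : ℕ} → Subset n → (Fin n → ℚ) → Fin n × Fin n → Fin (suc n) → ℚ
edgeVec B u (i , j) with i ∈? B | j ∈? B
... | no  _ | no  _ = vtx i ⊖ vtx j
... | no  _ | yes _ = vtx i ⊖ (u j · e₀vec)
... | yes _ | no  _ = vtx j ⊖ (u i · e₀vec)
... | yes _ | yes _ = λ _ → 0ℚ                     -- impossible in a network

dirichletVec : {n m : ℕ} → Ends n m → Subset n → (Fin n → ℚ) →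
               Fin (suc m) → Fin (suc n) → ℚ
dirichletVec ends B u zero    = e₀vec
dirichletVec ends B u (suc e) = edgeVec B u (ends e)

DirichletIndep : {n m : ℕ} → Ends n m → Subset n → (Fin n → ℚ) →
                 Subset (suc m) → Set
DirichletIndep ends B u S = LinIndep (dirichletVec ends B u) S

InjectiveOn : {n : ℕ} → Subset n → (Fin n → ℚ) → Set
InjectiveOn B u = ∀ a b → a ∈ B → b ∈ B → u a ≡ u b → a ≡ b

record CycleIn {n m : ℕ} (ends : Ends n m) (S : Subset m) : Set where
  field
    len      : ℕ
    verts    : Fin (suc (suc len)) → Fin n
    edges    : Fin (suc len) → Fin m
    closed   : verts zero ≡ verts (fromℕ (suc len))
    distV    : Injective _≡_ _≡_ (λ j → verts (inject₁ j))
    distE    : Injective _≡_ _≡_ edges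
    inS      : ∀ j → edges j ∈ S
    incident : ∀ j → Joins ends (edges j) (verts (inject₁ j)) (verts (suc j))

GraphicIndep : {n m : ℕ} → Ends n m → Subset m → Set
GraphicIndep ends S = ¬ CycleIn ends S

addEdge : {n m : ℕ} → Ends n m → Fin n → Fin n → Ends n (suc m)
addEdge ends a b zero    = (a , b)
addEdge ends a b (suc e) = ends e

image : {k : ℕ} → (Fin k ↔ Fin k) → Subset k → Subset k
image σ S = tabulate (λ j → lookup S (Inverse.from σ j))

MatroidIso : {k : ℕ} → (Subset k → Set) → (Subset k → Set) → Set
MatroidIso {k} I J =
  Σ (Fin k ↔ Fin k) λ σ → ∀ S → (I S → J (image σ S)) × (J (image σ S) → I S)

module Submission where

-- Both matroids are column matroids over ℚ once cycles are traded for
-- linear dependencies, so the proof compares vector families: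
--  * (Graph) the edge sets of a loopless graph containing a cycle are
--    exactly those whose incidence vectors e_tail − e_head are dependent:
--    a cycle gives a telescoping signed sum, and conversely a dependency
--    lets one walk forever along edges with nonzero coefficient without
--    backtracking, and the first repeated vertex closes a cycle;
--  * (Transfer) if w_g = t_g · L(v_g) with t_g ≠ 0 and the linear map L
--    kills no nonzero combination of the v_g, then v and w have the same
--    dependent sets;
--  * (TwoTerminal) the linear map β(w) = (u(b₁)w(b₁) + u(b₂)w(b₂), w|_{V∖B})
--    sends the incidence vectors of Γ̂ to nonzero multiples of the Dirichlet
--    vectors (the new edge b₁b₂ to a multiple of e₀), and β is injective on
--    vectors of coordinate sum 0, where all incidence combinations live.
-- The theorem then holds with the identity bijection of ground sets.

open import Defs
open import Data.Nat using (ℕ; zero; suc; _<_; _≤_; s≤s) renaming (_+_ to _+ℕ_)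
open import Data.Nat.Properties as ℕP using ()
open import Data.Fin using (Fin; zero; suc; _≟_; inject₁; fromℕ; toℕ; fromℕ<)
open import Data.Fin.Properties as FinP using (any?)
open import Data.Fin.Subset using (Subset; _∈_; _∉_; ∣_∣)
open import Data.Fin.Subset.Properties using (_∈?_; ∣p∣≤∣x∷p∣; x∈⁅y⁆⇒x≡y; p⊆q⇒∣p∣≤∣q∣; ∣⁅x⁆∣≡1)
open import Data.Vec using (_∷_)
open import Data.Vec.Base using (here; there)
open import Data.Vec.Properties using (tabulate∘lookup)
open import Data.Product using (_×_; _,_; proj₁; proj₂; Σ; ∃-syntax)
open import Data.Sum using (_⊎_; inj₁; inj₂)
open import Data.Rational using (ℚ; 0ℚ; 1ℚ; _+_; _*_; _-_; -_; 1/_; ≢-nonZero)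
open import Data.Rational.Properties as ℚP using ()
open import Data.Rational.Solver using (module +-*-Solver)
open import Data.Empty using (⊥-elim)
open import Relation.Binary.PropositionalEquality
open import Relation.Binary.Definitions using (tri<; tri≈; tri>)
open import Relation.Nullary using (¬_; yes; no)
open import Relation.Nullary.Decidable using (¬?; _×-dec_)
open import Function.Definitions using (Injective)
open import Function.Bundles using (_⇔_; mk⇔; Equivalence)
open import Function.Construct.Identity using (↔-id)
open import Function.Construct.Composition using (_⇔-∘_)
import Function.Properties.Equivalence as ⇔

open +-*-Solver
open ≡-Reasoning

inv : (p : ℚ) → p ≢ 0ℚ → ℚ
inv p p≢0 = (1/ p) {{≢-nonZero p≢0}}

inv-inverseˡ : ∀ p (p≢0 : p ≢ 0ℚ) → inv p p≢0 * p ≡ 1ℚ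
inv-inverseˡ p p≢0 = ℚP.*-inverseˡ p {{≢-nonZero p≢0}}

inv≢0 : ∀ p (p≢0 : p ≢ 0ℚ) → inv p p≢0 ≢ 0ℚ
inv≢0 p p≢0 inv≡0 = 1≢0 (begin
    1ℚ             ≡⟨ sym (inv-inverseˡ p p≢0) ⟩
    inv p p≢0 * p  ≡⟨ cong (_* p) inv≡0 ⟩
    0ℚ * p         ≡⟨ ℚP.*-zeroˡ p ⟩
    0ℚ             ∎)
  where
    1≢0 : 1ℚ ≢ 0ℚ
    1≢0 ()

*-nonzero : ∀ a b → a ≢ 0ℚ → b ≢ 0ℚ → a * b ≢ 0ℚ
*-nonzero a b a≢0 b≢0 ab≡0 = b≢0 (begin
    b                  ≡⟨ sym (ℚP.*-identityˡ b) ⟩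
    1ℚ * b             ≡⟨ cong (_* b) (sym (inv-inverseˡ a a≢0)) ⟩
    (a⁻¹ * a) * b      ≡⟨ ℚP.*-assoc a⁻¹ a b ⟩
    a⁻¹ * (a * b)      ≡⟨ cong (a⁻¹ *_) ab≡0 ⟩
    a⁻¹ * 0ℚ           ≡⟨ ℚP.*-zeroʳ a⁻¹ ⟩
    0ℚ                 ∎)
  where
    a⁻¹ : ℚ
    a⁻¹ = inv a a≢0

≢⇒difference≢0 : ∀ α β → α ≢ β → α - β ≢ 0ℚ
≢⇒difference≢0 α β α≢β α-β≡0 = α≢β (begin
    α              ≡⟨ solve 2 (λ a b → a := (a :- b) :+ b) refl α β ⟩
    (α - β) + β    ≡⟨ cong (_+ β) α-β≡0 ⟩
    0ℚ + β         ≡⟨ ℚP.+-identityˡ β ⟩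
    β              ∎)

two-equations : ∀ α β x y → α ≢ β → α * x + β * y ≡ 0ℚ → x + y ≡ 0ℚ → x ≡ 0ℚ × y ≡ 0ℚ
two-equations α β x y α≢β αx+βy≡0 x+y≡0 = x≡0 , y≡0
  where
    [α-β]x≡0 : (α - β) * x ≡ 0ℚ
    [α-β]x≡0 = begin
      (α - β) * x                   ≡⟨ solve 4 (λ a b x y → (a :- b) :* x := (a :* x :+ b :* y) :- b :* (x :+ y)) refl α β x y ⟩
      (α * x + β * y) - β * (x + y) ≡⟨ cong₂ (λ p q → p - β * q) αx+βy≡0 x+y≡0 ⟩
      0ℚ - β * 0ℚ                   ≡⟨ solve 1 (λ b → con 0ℚ :- b :* con 0ℚ := con 0ℚ) refl β ⟩
      0ℚ                            ∎
    x≡0 : x ≡ 0ℚ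
    x≡0 with x ℚP.≟ 0ℚ
    ... | yes x≡0 = x≡0
    ... | no x≢0  = ⊥-elim (*-nonzero (α - β) x (≢⇒difference≢0 α β α≢β) x≢0 [α-β]x≡0)
    y≡0 : y ≡ 0ℚ
    y≡0 = begin
      y             ≡⟨ solve 2 (λ x y → y := (x :+ y) :- x) refl x y ⟩
      (x + y) - x   ≡⟨ cong₂ _-_ x+y≡0 x≡0 ⟩
      0ℚ - 0ℚ       ≡⟨ ℚP.+-inverseʳ 0ℚ ⟩
      0ℚ            ∎

member⇒1≤∣p∣ : {n : ℕ} {p : Subset n} {x : Fin n} → x ∈ p → 1 ≤ ∣ p ∣
member⇒1≤∣p∣ {p = p} {x} x∈p = subst (_≤ ∣ p ∣) (∣⁅x⁆∣≡1 x)
  (p⊆q⇒∣p∣≤∣q∣ (λ z∈⁅x⁆ → subst (_∈ p) (sym (x∈⁅y⁆⇒x≡y x z∈⁅x⁆)) x∈p))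

two-members⇒2≤∣p∣ : {n : ℕ} {p : Subset n} {x y : Fin n} → x ≢ y → x ∈ p → y ∈ p → 2 ≤ ∣ p ∣
two-members⇒2≤∣p∣ x≢y here here = ⊥-elim (x≢y refl)
two-members⇒2≤∣p∣ x≢y here (there y∈p) = s≤s (member⇒1≤∣p∣ y∈p)
two-members⇒2≤∣p∣ x≢y (there x∈p) here = s≤s (member⇒1≤∣p∣ x∈p)
two-members⇒2≤∣p∣ {p = b ∷ p} x≢y (there x∈p) (there y∈p) =
  ℕP.≤-trans (two-members⇒2≤∣p∣ (λ x≡y → x≢y (cong suc x≡y)) x∈p y∈p) (∣p∣≤∣x∷p∣ b p)

three-members⇒3≤∣p∣ : {n : ℕ} {p : Subset n} {x y z : Fin n} → x ≢ y → x ≢ z → y ≢ z →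
                      x ∈ p → y ∈ p → z ∈ p → 3 ≤ ∣ p ∣
three-members⇒3≤∣p∣ x≢y x≢z y≢z here here _ = ⊥-elim (x≢y refl)
three-members⇒3≤∣p∣ x≢y x≢z y≢z here _ here = ⊥-elim (x≢z refl)
three-members⇒3≤∣p∣ x≢y x≢z y≢z _ here here = ⊥-elim (y≢z refl)
three-members⇒3≤∣p∣ x≢y x≢z y≢z here (there y∈p) (there z∈p) =
  s≤s (two-members⇒2≤∣p∣ (λ y≡z → y≢z (cong suc y≡z)) y∈p z∈p)
three-members⇒3≤∣p∣ x≢y x≢z y≢z (there x∈p) here (there z∈p) =
  s≤s (two-members⇒2≤∣p∣ (λ x≡z → x≢z (cong suc x≡z)) x∈p z∈p)
three-members⇒3≤∣p∣ x≢y x≢z y≢z (there x∈p) (there y∈p) here =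
  s≤s (two-members⇒2≤∣p∣ (λ x≡y → x≢y (cong suc x≡y)) x∈p y∈p)
three-members⇒3≤∣p∣ {p = b ∷ p} x≢y x≢z y≢z (there x∈p) (there y∈p) (there z∈p) =
  ℕP.≤-trans (three-members⇒3≤∣p∣ (λ e → x≢y (cong suc e)) (λ e → x≢z (cong suc e)) (λ e → y≢z (cong suc e))
                                  x∈p y∈p z∈p)
             (∣p∣≤∣x∷p∣ b p)

members-of-pair : {n : ℕ} {p : Subset n} {x y : Fin n} → ∣ p ∣ ≡ 2 → x ≢ y → x ∈ p → y ∈ p →
                  ∀ z → z ∈ p → z ≡ x ⊎ z ≡ y
members-of-pair {x = x} {y} ∣p∣≡2 x≢y x∈p y∈p z z∈p with z ≟ x | z ≟ y
... | yes z≡x | _       = inj₁ z≡x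
... | no _    | yes z≡y = inj₂ z≡y
... | no z≢x  | no z≢y  = ⊥-elim (3≰2 (subst (3 ≤_) ∣p∣≡2
        (three-members⇒3≤∣p∣ x≢y (λ x≡z → z≢x (sym x≡z)) (λ y≡z → z≢y (sym y≡z)) x∈p y∈p z∈p)))
  where 3≰2 : ¬ 3 ≤ 2
        3≰2 (s≤s (s≤s ()))

basis-suc : {d : ℕ} (i j : Fin d) → basis {suc d} (suc i) (suc j) ≡ basis i j
basis-suc i j with i ≟ j
... | yes _ = refl
... | no _  = refl

basis-same : {d : ℕ} (i : Fin d) → basis i i ≡ 1ℚ
basis-same zero    = refl
basis-same (suc i) = trans (basis-suc i i) (basis-same i)

basis-diff : {d : ℕ} (i j : Fin d) → i ≢ j → basis i j ≡ 0ℚ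
basis-diff i j i≢j with i ≟ j
... | yes i≡j = ⊥-elim (i≢j i≡j)
... | no _    = refl

basis-sym : {d : ℕ} (i j : Fin d) → basis i j ≡ basis j i
basis-sym i j with i ≟ j | j ≟ i
... | yes _    | yes _    = refl
... | no _     | no _     = refl
... | yes i≡j  | no j≢i   = ⊥-elim (j≢i (sym i≡j))
... | no i≢j   | yes j≡i  = ⊥-elim (i≢j (sym j≡i))

basis-injective : {d e : ℕ} (h : Fin d → Fin e) → Injective _≡_ _≡_ h →
                  (i j : Fin d) → basis (h i) (h j) ≡ basis i j
basis-injective h inj i j with i ≟ j
... | yes refl = basis-same (h i)
... | no i≢j   = basis-diff (h i) (h j) (λ hi≡hj → i≢j (inj hi≡hj))

Σ-cong : ∀ k {f g : Fin k → ℚ} → (∀ i → f i ≡ g i) → Σℚ k f ≡ Σℚ k g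
Σ-cong zero    f≡g = refl
Σ-cong (suc k) f≡g = cong₂ _+_ (f≡g zero) (Σ-cong k (λ i → f≡g (suc i)))

Σ-zero : ∀ k {f : Fin k → ℚ} → (∀ i → f i ≡ 0ℚ) → Σℚ k f ≡ 0ℚ
Σ-zero zero    f≡0 = refl
Σ-zero (suc k) f≡0 = cong₂ _+_ (f≡0 zero) (Σ-zero k (λ i → f≡0 (suc i)))

Σ-+ : ∀ k (f g : Fin k → ℚ) → Σℚ k (λ i → f i + g i) ≡ Σℚ k f + Σℚ k g
Σ-+ zero    f g = refl
Σ-+ (suc k) f g = trans (cong ((f zero + g zero) +_) (Σ-+ k _ _))
  (solve 4 (λ a b c d → (a :+ b) :+ (c :+ d) := (a :+ c) :+ (b :+ d)) refl
    (f zero) (g zero) (Σℚ k (λ i → f (suc i))) (Σℚ k (λ i → g (suc i))))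

Σ-- : ∀ k (f g : Fin k → ℚ) → Σℚ k (λ i → f i - g i) ≡ Σℚ k f - Σℚ k g
Σ-- zero    f g = refl
Σ-- (suc k) f g = trans (cong ((f zero - g zero) +_) (Σ-- k _ _))
  (solve 4 (λ a b c d → (a :- b) :+ (c :- d) := (a :+ c) :- (b :+ d)) refl
    (f zero) (g zero) (Σℚ k (λ i → f (suc i))) (Σℚ k (λ i → g (suc i))))

Σ-* : ∀ k (a : ℚ) (f : Fin k → ℚ) → Σℚ k (λ i → a * f i) ≡ a * Σℚ k f
Σ-* zero    a f = sym (ℚP.*-zeroʳ a)
Σ-* (suc k) a f = trans (cong ((a * f zero) +_) (Σ-* k a _))
  (sym (ℚP.*-distribˡ-+ a (f zero) (Σℚ k (λ i → f (suc i)))))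

Σ-swap : ∀ k l (f : Fin k → Fin l → ℚ) →
         Σℚ k (λ i → Σℚ l (f i)) ≡ Σℚ l (λ j → Σℚ k (λ i → f i j))
Σ-swap zero    l f = sym (Σ-zero l (λ _ → refl))
Σ-swap (suc k) l f = trans (cong (Σℚ l (f zero) +_) (Σ-swap k l (λ i → f (suc i))))
  (sym (Σ-+ l (f zero) (λ j → Σℚ k (λ i → f (suc i) j))))

Σ-pick : ∀ k (h : Fin k) (F : Fin k → ℚ) → Σℚ k (λ g → basis h g * F g) ≡ F h
Σ-pick (suc k) zero F =
  trans (cong₂ _+_ (ℚP.*-identityˡ (F zero)) (Σ-zero k (λ i → ℚP.*-zeroˡ (F (suc i)))))
        (ℚP.+-identityʳ (F zero))
Σ-pick (suc k) (suc h) F =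
  trans (cong₂ _+_ (ℚP.*-zeroˡ (F zero))
                   (trans (Σ-cong k (λ i → cong (_* F (suc i)) (basis-suc h i)))
                          (Σ-pick k h (λ i → F (suc i)))))
        (ℚP.+-identityˡ _)

Σ-basis : ∀ k (h : Fin k) → Σℚ k (basis h) ≡ 1ℚ
Σ-basis k h = trans (Σ-cong k (λ g → sym (ℚP.*-identityʳ (basis h g)))) (Σ-pick k h (λ _ → 1ℚ))

Σ≡0⇒another-nonzero : ∀ k (F : Fin k → ℚ) → Σℚ k F ≡ 0ℚ → ∀ g → F g ≢ 0ℚ →
                      ∃[ g′ ] g′ ≢ g × F g′ ≢ 0ℚ
Σ≡0⇒another-nonzero k F ΣF≡0 g Fg≢0
  with any? (λ g′ → ¬? (g′ ≟ g) ×-dec ¬? (F g′ ℚP.≟ 0ℚ))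
... | yes found = found
... | no none   = ⊥-elim (Fg≢0 (begin
    F g                             ≡⟨ sym (Σ-pick k g F) ⟩
    Σℚ k (λ g′ → basis g g′ * F g′) ≡⟨ Σ-cong k only-g ⟩
    Σℚ k F                          ≡⟨ ΣF≡0 ⟩
    0ℚ                              ∎))
  where
    only-g : ∀ g′ → basis g g′ * F g′ ≡ F g′
    only-g g′ with g ≟ g′
    ... | yes refl = ℚP.*-identityˡ (F g′)
    ... | no g≢g′ with F g′ ℚP.≟ 0ℚ
    ...   | yes Fg′≡0 = trans (ℚP.*-zeroˡ (F g′)) (sym Fg′≡0)
    ...   | no Fg′≢0  = ⊥-elim (none (g′ , (λ g′≡g → g≢g′ (sym g′≡g)) , Fg′≢0))

lincomb : {k d : ℕ} → (Fin k → ℚ) → (Fin k → Fin d → ℚ) → Fin d → ℚ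
lincomb {k} c v y = Σℚ k (λ g → c g * v g y)

record Dependency {k d : ℕ} (v : Fin k → Fin d → ℚ) (S : Subset k) : Set where
  field
    coeff    : Fin k → ℚ
    support  : ∀ g → g ∉ S → coeff g ≡ 0ℚ
    vanishes : ∀ y → lincomb coeff v y ≡ 0ℚ
    witness  : Fin k
    nonzero  : coeff witness ≢ 0ℚ

-- Over ℚ (decidable equality), independence is the absence of a dependency.
indep⇔no-dependency : {k d : ℕ} (v : Fin k → Fin d → ℚ) (S : Subset k) →
                      LinIndep v S ⇔ (¬ Dependency v S)
indep⇔no-dependency v S = mk⇔ indep⇒no-dep no-dep⇒indep
  where
    indep⇒no-dep : LinIndep v S → ¬ Dependency v S
    indep⇒no-dep indep dep = nonzero (indep coeff support vanishes witness)
      where open Dependency dep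

    no-dep⇒indep : ¬ Dependency v S → LinIndep v S
    no-dep⇒indep no-dep c support vanishes i with c i ℚP.≟ 0ℚ
    ... | yes ci≡0 = ci≡0
    ... | no ci≢0  = ⊥-elim (no-dep (record
      { coeff = c ; support = support ; vanishes = vanishes ; witness = i ; nonzero = ci≢0 }))

record LinearMap (d e : ℕ) : Set where
  field
    apply      : (Fin d → ℚ) → Fin e → ℚ
    apply-cong : ∀ {w w′} → (∀ y → w y ≡ w′ y) → ∀ x → apply w x ≡ apply w′ x
    linear     : ∀ {k} (c : Fin k → ℚ) (v : Fin k → Fin d → ℚ) x →
                 apply (lincomb c v) x ≡ Σℚ k (λ g → c g * apply (v g) x)

module Transfer {k d e : ℕ} (v : Fin k → Fin d → ℚ) (w : Fin k → Fin e → ℚ)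
                (L : LinearMap d e) (t : Fin k → ℚ) (t≢0 : ∀ g → t g ≢ 0ℚ)
                (w≡tLv : ∀ g x → w g x ≡ t g * LinearMap.apply L (v g) x)
                (faithful : ∀ c → (∀ x → LinearMap.apply L (lincomb c v) x ≡ 0ℚ) →
                            ∀ y → lincomb c v y ≡ 0ℚ) where
  open LinearMap L

  lincomb-w : ∀ c x → lincomb c w x ≡ apply (lincomb (λ g → c g * t g) v) x
  lincomb-w c x = begin
    Σℚ k (λ g → c g * w g x)                 ≡⟨ Σ-cong k (λ g → trans (cong (c g *_) (w≡tLv g x))
                                                   (sym (ℚP.*-assoc (c g) (t g) _))) ⟩
    Σℚ k (λ g → (c g * t g) * apply (v g) x) ≡⟨ sym (linear (λ g → c g * t g) v x) ⟩
    apply (lincomb (λ g → c g * t g) v) x    ∎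

  scaled-support : {S : Subset k} (c s : Fin k → ℚ) → (∀ g → g ∉ S → c g ≡ 0ℚ) →
                   ∀ g → g ∉ S → c g * s g ≡ 0ℚ
  scaled-support c s support g g∉S = trans (cong (_* s g) (support g g∉S)) (ℚP.*-zeroˡ (s g))

  w-dependency⇒v-dependency : ∀ {S} → Dependency w S → Dependency v S
  w-dependency⇒v-dependency dep = record
    { coeff    = λ g → coeff g * t g
    ; support  = scaled-support coeff t support
    ; vanishes = faithful (λ g → coeff g * t g)
                          (λ x → trans (sym (lincomb-w coeff x)) (vanishes x))
    ; witness  = witness
    ; nonzero  = *-nonzero (coeff witness) (t witness) nonzero (t≢0 witness)
    }
    where open Dependency dep

  v-dependency⇒w-dependency : ∀ {S} → Dependency v S → Dependency w S
  v-dependency⇒w-dependency dep = record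
    { coeff    = c′
    ; support  = scaled-support coeff t⁻¹ support
    ; vanishes = λ x → begin
        lincomb c′ w x                       ≡⟨ lincomb-w c′ x ⟩
        apply (lincomb (λ g → c′ g * t g) v) x ≡⟨ apply-cong lincomb-c′t≡0 x ⟩
        apply (λ _ → 0ℚ) x                   ≡⟨ linear {0} (λ ()) (λ ()) x ⟩
        0ℚ                                   ∎
    ; witness  = witness
    ; nonzero  = *-nonzero (coeff witness) (t⁻¹ witness) nonzero (inv≢0 (t witness) (t≢0 witness))
    }
    where
      open Dependency dep
      t⁻¹ : Fin k → ℚ
      t⁻¹ g = inv (t g) (t≢0 g)
      c′ : Fin k → ℚ
      c′ g = coeff g * t⁻¹ g
      lincomb-c′t≡0 : ∀ y → lincomb (λ g → c′ g * t g) v y ≡ 0ℚ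
      lincomb-c′t≡0 y = trans (Σ-cong k (λ g → cong (_* v g y) (begin
          (coeff g * t⁻¹ g) * t g ≡⟨ ℚP.*-assoc (coeff g) _ _ ⟩
          coeff g * (t⁻¹ g * t g) ≡⟨ cong (coeff g *_) (inv-inverseˡ (t g) (t≢0 g)) ⟩
          coeff g * 1ℚ            ≡⟨ ℚP.*-identityʳ (coeff g) ⟩
          coeff g                 ∎)))
        (vanishes y)

  no-dependency⇔ : ∀ {S} → (¬ Dependency w S) ⇔ (¬ Dependency v S)
  no-dependency⇔ = mk⇔ (λ no-w dep → no-w (v-dependency⇒w-dependency dep))
                       (λ no-v dep → no-v (w-dependency⇒v-dependency dep))

telescope : ∀ N (f : Fin (suc N) → ℚ) →
            Σℚ N (λ j → f (inject₁ j) - f (suc j)) ≡ f zero - f (fromℕ N)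
telescope zero    f = sym (ℚP.+-inverseʳ (f zero))
telescope (suc N) f = trans (cong ((f zero - f (suc zero)) +_) (telescope N (λ j → f (suc j))))
  (solve 3 (λ a b c → (a :- b) :+ (b :- c) := a :- c) refl (f zero) (f (suc zero)) (f (fromℕ (suc N))))

DistinctBelow : {n : ℕ} → (ℕ → Fin n) → ℕ → Set
DistinctBelow f j = ∀ a b → a < b → b < j → f a ≢ f b

record FirstRepetition {n : ℕ} (f : ℕ → Fin n) : Set where
  field
    start len : ℕ
    repeats   : f start ≡ f (start +ℕ suc len)
    distinct  : DistinctBelow f (start +ℕ suc len)

scan-repetition : {n : ℕ} (f : ℕ → Fin n) (J : ℕ) → DistinctBelow f (suc J) ⊎ FirstRepetition f
scan-repetition f zero = inj₁ (λ { a zero () _ ; a (suc b) _ (s≤s ()) })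
scan-repetition f (suc J) with scan-repetition f J
... | inj₂ repetition = inj₂ repetition
... | inj₁ distinct with any? (λ (t : Fin (suc J)) → f (toℕ t) ≟ f (suc J))
...   | yes (t , ft≡fJ) = inj₂ (record
          { start = toℕ t ; len = o
          ; repeats = trans ft≡fJ (cong f (sym t+o≡J))
          ; distinct = subst (DistinctBelow f) (sym t+o≡J) distinct })
  where
    o : ℕ
    o = proj₁ (ℕP.m≤n⇒∃[o]m+o≡n (FinP.toℕ<n t))
    t+o≡J : toℕ t +ℕ suc o ≡ suc J
    t+o≡J = trans (ℕP.+-suc (toℕ t) o) (proj₂ (ℕP.m≤n⇒∃[o]m+o≡n (FinP.toℕ<n t)))
...   | no none = inj₁ extended
  where
    extended : DistinctBelow f (suc (suc J))
    extended a b a<b (s≤s b≤J+1) with ℕP.m≤n⇒m<n∨m≡n b≤J+1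
    ... | inj₁ b<J+1 = distinct a b a<b b<J+1
    ... | inj₂ refl  = λ fa≡fb → none (fromℕ< a<b , trans (cong f (FinP.toℕ-fromℕ< a<b)) fa≡fb)

first-repetition : {n : ℕ} (f : ℕ → Fin n) → FirstRepetition f
first-repetition {n} f with scan-repetition f n
... | inj₂ repetition = repetition
... | inj₁ distinct with FinP.pigeonhole (ℕP.n<1+n n) (λ (t : Fin (suc n)) → f (toℕ t))
...   | (a , b , a<b , fa≡fb) = ⊥-elim (distinct (toℕ a) (toℕ b) a<b (FinP.toℕ<n b) fa≡fb)

module Graph {n k : ℕ} (E : Ends n k) where

  tail head : Fin k → Fin n
  tail g = proj₁ (E g)
  head g = proj₂ (E g)

  incidence : Fin k → Fin n → ℚ
  incidence g y = basis (tail g) y - basis (head g) y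

  incidence-sum : ∀ g → Σℚ n (incidence g) ≡ 0ℚ
  incidence-sum g = begin
    Σℚ n (incidence g)                             ≡⟨ Σ-- n (basis (tail g)) (basis (head g)) ⟩
    Σℚ n (basis (tail g)) - Σℚ n (basis (head g)) ≡⟨ cong₂ _-_ (Σ-basis n (tail g)) (Σ-basis n (head g)) ⟩
    1ℚ - 1ℚ                                        ≡⟨ ℚP.+-inverseʳ 1ℚ ⟩
    0ℚ                                             ∎

  lincomb-incidence-sum : ∀ c → Σℚ n (lincomb c incidence) ≡ 0ℚ
  lincomb-incidence-sum c = begin
    Σℚ n (lincomb c incidence)                     ≡⟨ Σ-swap n k (λ y g → c g * incidence g y) ⟩
    Σℚ k (λ g → Σℚ n (λ y → c g * incidence g y)) ≡⟨ Σ-cong k (λ g → trans (Σ-* n (c g) (incidence g))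
                                                        (trans (cong (c g *_) (incidence-sum g)) (ℚP.*-zeroʳ (c g)))) ⟩
    Σℚ k (λ _ → 0ℚ)                                ≡⟨ Σ-zero k (λ _ → refl) ⟩
    0ℚ                                             ∎

  orientation : ∀ {e a b} → Joins E e a b → ℚ
  orientation (inj₁ _) = 1ℚ
  orientation (inj₂ _) = - 1ℚ

  orientation≢0 : ∀ {e a b} (J : Joins E e a b) → orientation J ≢ 0ℚ
  orientation≢0 (inj₁ _) ()
  orientation≢0 (inj₂ _) ()

  orientation-incidence : ∀ {e a b} (J : Joins E e a b) y →
                          orientation J * incidence e y ≡ basis a y - basis b y
  orientation-incidence (inj₁ refl) y = ℚP.*-identityˡ _
  orientation-incidence {a = a} {b} (inj₂ refl) y =
    solve 2 (λ a b → (:- con 1ℚ) :* (b :- a) := a :- b) refl (basis a y) (basis b y)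

  joins-same-edge : ∀ {e a b c d} → Joins E e a b → Joins E e c d →
                    (a ≡ c × b ≡ d) ⊎ (a ≡ d × b ≡ c)
  joins-same-edge (inj₁ refl) (inj₁ eq) = inj₁ (cong proj₁ eq , cong proj₂ eq)
  joins-same-edge (inj₁ refl) (inj₂ eq) = inj₂ (cong proj₁ eq , cong proj₂ eq)
  joins-same-edge (inj₂ refl) (inj₁ eq) = inj₂ (cong proj₂ eq , cong proj₁ eq)
  joins-same-edge (inj₂ refl) (inj₂ eq) = inj₁ (cong proj₂ eq , cong proj₁ eq)

  -- A cycle gives a dependency: weight each of its edges by the orientation
  -- in which the cycle traverses it; the weighted sum telescopes to 0.
  cycle⇒dependency : ∀ {S} → CycleIn E S → Dependency incidence S
  cycle⇒dependency {S} C = record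
    { coeff = c ; support = support ; vanishes = vanishes
    ; witness = edges zero ; nonzero = nonzero }
    where
      open CycleIn C
      sgn : Fin (suc len) → ℚ
      sgn j = orientation (incident j)

      c : Fin k → ℚ
      c g = Σℚ (suc len) (λ j → basis (edges j) g * sgn j)

      support : ∀ g → g ∉ S → c g ≡ 0ℚ
      support g g∉S = Σ-zero (suc len) (λ j →
        trans (cong (_* sgn j) (basis-diff (edges j) g (λ eⱼ≡g → g∉S (subst (_∈ S) eⱼ≡g (inS j)))))
              (ℚP.*-zeroˡ (sgn j)))

      -- distinct edges: c (edges j) is the orientation sgn j
      nonzero : c (edges zero) ≢ 0ℚ
      nonzero c≡0 = orientation≢0 (incident zero) (begin
        sgn zero                                     ≡⟨ sym (Σ-pick (suc len) zero sgn) ⟩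
        Σℚ (suc len) (λ j → basis zero j * sgn j)    ≡⟨ Σ-cong (suc len) (λ j → cong (_* sgn j)
                                                          (trans (basis-sym zero j) (sym (basis-injective edges distE j zero)))) ⟩
        c (edges zero)                               ≡⟨ c≡0 ⟩
        0ℚ                                           ∎)

      vanishes : ∀ y → lincomb c incidence y ≡ 0ℚ
      vanishes y = begin
        Σℚ k (λ g → c g * incidence g y)
          ≡⟨ Σ-cong k (λ g → trans (ℚP.*-comm (c g) (incidence g y))
               (trans (sym (Σ-* (suc len) (incidence g y) (λ j → basis (edges j) g * sgn j)))
                 (Σ-cong (suc len) (λ j → solve 3 (λ a b s → a :* (b :* s) := b :* (s :* a)) refl
                     (incidence g y) (basis (edges j) g) (sgn j))))) ⟩
        Σℚ k (λ g → Σℚ (suc len) (λ j → basis (edges j) g * (sgn j * incidence g y)))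
          ≡⟨ Σ-swap k (suc len) (λ g j → basis (edges j) g * (sgn j * incidence g y)) ⟩
        Σℚ (suc len) (λ j → Σℚ k (λ g → basis (edges j) g * (sgn j * incidence g y)))
          ≡⟨ Σ-cong (suc len) (λ j → trans (Σ-pick k (edges j) (λ g → sgn j * incidence g y))
                                           (orientation-incidence (incident j) y)) ⟩
        Σℚ (suc len) (λ j → basis (verts (inject₁ j)) y - basis (verts (suc j)) y)
          ≡⟨ telescope (suc len) (λ t → basis (verts t) y) ⟩
        basis (verts zero) y - basis (verts (fromℕ (suc len))) y
          ≡⟨ cong (λ v → basis v y - basis (verts (fromℕ (suc len))) y) closed ⟩
        basis (verts (fromℕ (suc len))) y - basis (verts (fromℕ (suc len))) y
          ≡⟨ ℚP.+-inverseʳ (basis (verts (fromℕ (suc len))) y) ⟩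
        0ℚ ∎

  record NonBacktrackingWalk : Set where
    field
      vert        : ℕ → Fin n
      edge        : ℕ → Fin k
      step        : ∀ i → Joins E (edge i) (vert i) (vert (suc i))
      noBacktrack : ∀ i → edge (suc i) ≢ edge i

  -- Such a walk contains a cycle: cut it at the first repeated vertex.
  -- Vertices between the repetition are distinct, and so are the edges,
  -- since a reused edge would either repeat a vertex earlier or backtrack.
  walk⇒cycle : (W : NonBacktrackingWalk) {S : Subset k} →
               (∀ i → NonBacktrackingWalk.edge W i ∈ S) → CycleIn E S
  walk⇒cycle W {S} inS = record
    { len = len
    ; verts = λ t → vert (start +ℕ toℕ t)
    ; edges = λ t → edge (start +ℕ toℕ t)
    ; closed = trans (cong vert (ℕP.+-identityʳ start))
                     (trans repeats (cong (λ x → vert (start +ℕ x)) (sym (FinP.toℕ-fromℕ (suc len)))))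
    ; distV = λ {t} {t′} eq → FinP.inject₁-injective (FinP.toℕ-injective (ℕP.+-cancelˡ-≡ start _ _
                (vert-injective _ _ (before-end (inject₁-bound t)) (before-end (inject₁-bound t′)) eq)))
    ; distE = distinct-edges
    ; inS = λ t → inS (start +ℕ toℕ t)
    ; incident = λ t → subst₂ (Joins E (edge (start +ℕ toℕ t)))
        (cong (λ x → vert (start +ℕ x)) (sym (FinP.toℕ-inject₁ t)))
        (cong vert (sym (ℕP.+-suc start (toℕ t))))
        (step (start +ℕ toℕ t))
    }
    where
      open NonBacktrackingWalk W
      open FirstRepetition (first-repetition vert)
      end : ℕ
      end = start +ℕ suc len

      before-end : ∀ {x} → x < suc len → start +ℕ x < end
      before-end x<len+1 = ℕP.+-monoʳ-< start x<len+1

      inject₁-bound : (t : Fin (suc len)) → toℕ (inject₁ t) < suc len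
      inject₁-bound t = subst (_< suc len) (sym (FinP.toℕ-inject₁ t)) (FinP.toℕ<n t)

      vert-injective : ∀ a b → a < end → b < end → vert a ≡ vert b → a ≡ b
      vert-injective a b a<end b<end eq with ℕP.<-cmp a b
      ... | tri< a<b _ _ = ⊥-elim (distinct a b a<b b<end eq)
      ... | tri≈ _ a≡b _ = a≡b
      ... | tri> _ _ b<a = ⊥-elim (distinct b a b<a a<end (sym eq))

      edge-not-reused : ∀ a b → a < b → b < end → edge a ≢ edge b
      edge-not-reused a b a<b b<end eq
        with joins-same-edge (step a) (subst (λ e → Joins E e (vert b) (vert (suc b))) (sym eq) (step b))
      ... | inj₁ (va≡vb , _) = distinct a b a<b b<end va≡vb
      ... | inj₂ (_ , va+1≡vb) with ℕP.m≤n⇒m<n∨m≡n a<b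
      ...   | inj₁ a+1<b = distinct (suc a) b a+1<b b<end va+1≡vb
      ...   | inj₂ a+1≡b = noBacktrack a (trans (cong edge a+1≡b) (sym eq))

      distinct-edges : Injective _≡_ _≡_ (λ (t : Fin (suc len)) → edge (start +ℕ toℕ t))
      distinct-edges {t} {t′} eq with ℕP.<-cmp (toℕ t) (toℕ t′)
      ... | tri< t<t′ _ _ = ⊥-elim (edge-not-reused _ _ (ℕP.+-monoʳ-< start t<t′) (before-end (FinP.toℕ<n t′)) eq)
      ... | tri≈ _ t≡t′ _ = FinP.toℕ-injective t≡t′
      ... | tri> _ _ t′<t = ⊥-elim (edge-not-reused _ _ (ℕP.+-monoʳ-< start t′<t) (before-end (FinP.toℕ<n t)) (sym eq))

  joins-distinct : NoLoops E → ∀ {e a b} → Joins E e a b → a ≢ b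
  joins-distinct noLoops {e} (inj₁ refl) a≡b = noLoops e a≡b
  joins-distinct noLoops {e} (inj₂ refl) a≡b = noLoops e (sym a≡b)

  incidence-at-endpoint : NoLoops E → ∀ {e a b} → Joins E e a b → incidence e b ≢ 0ℚ
  incidence-at-endpoint noLoops {e} {a} {b} J inc≡0 = -1≢0 (begin
    - 1ℚ                          ≡⟨ cong₂ _-_ (sym (basis-diff a b a≢b)) (sym (basis-same b)) ⟩
    basis a b - basis b b         ≡⟨ sym (orientation-incidence J b) ⟩
    orientation J * incidence e b ≡⟨ cong (orientation J *_) inc≡0 ⟩
    orientation J * 0ℚ            ≡⟨ ℚP.*-zeroʳ (orientation J) ⟩
    0ℚ                            ∎)
    where
      -1≢0 : - 1ℚ ≢ 0ℚ
      -1≢0 ()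
      a≢b : a ≢ b
      a≢b = joins-distinct noLoops J

  incidence≢0⇒endpoint : ∀ g w → incidence g w ≢ 0ℚ → ∃[ w′ ] Joins E g w w′
  incidence≢0⇒endpoint g w inc≢0 with tail g ≟ w | head g ≟ w
  ... | yes refl | _        = head g , inj₁ refl
  ... | no _     | yes refl = tail g , inj₂ refl
  ... | no _     | no _     = ⊥-elim (inc≢0 (ℚP.+-inverseʳ 0ℚ))

  -- From a dependency, walk along edges with nonzero coefficient: the
  -- dependency vanishes at the current vertex, so besides the edge we
  -- arrived by some other edge with nonzero coefficient leaves it.
  module DependencyWalk (noLoops : NoLoops E) {S : Subset k} (dep : Dependency incidence S) where
    open Dependency dep

    record Step : Set where
      field
        from to : Fin n
        edge    : Fin k
        joins   : Joins E edge from to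
        used    : coeff edge ≢ 0ℚ

    continue : (s : Step) → Σ Step λ s′ → Step.from s′ ≡ Step.to s × Step.edge s′ ≢ Step.edge s
    continue s with Σ≡0⇒another-nonzero k (λ g → coeff g * incidence g (Step.to s)) (vanishes (Step.to s))
                      (Step.edge s) (*-nonzero _ _ (Step.used s) (incidence-at-endpoint noLoops (Step.joins s)))
    ... | g , g≢e , term≢0 = record { from = Step.to s ; to = w′ ; edge = g ; joins = joins ; used = used } , refl , g≢e
      where
        used : coeff g ≢ 0ℚ
        used coeff≡0 = term≢0 (trans (cong (_* incidence g (Step.to s)) coeff≡0) (ℚP.*-zeroˡ (incidence g (Step.to s))))
        inc≢0 : incidence g (Step.to s) ≢ 0ℚ
        inc≢0 inc≡0 = term≢0 (trans (cong (coeff g *_) inc≡0) (ℚP.*-zeroʳ (coeff g)))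
        w′ : Fin n
        w′ = proj₁ (incidence≢0⇒endpoint g (Step.to s) inc≢0)
        joins : Joins E g (Step.to s) w′
        joins = proj₂ (incidence≢0⇒endpoint g (Step.to s) inc≢0)

    steps : ℕ → Step
    steps zero    = record { from = tail witness ; to = head witness ; edge = witness
                           ; joins = inj₁ refl ; used = nonzero }
    steps (suc i) = proj₁ (continue (steps i))

    walk : NonBacktrackingWalk
    walk = record
      { vert = λ i → Step.from (steps i)
      ; edge = λ i → Step.edge (steps i)
      ; step = λ i → subst (Joins E (Step.edge (steps i)) (Step.from (steps i)))
                           (sym (proj₁ (proj₂ (continue (steps i))))) (Step.joins (steps i))
      ; noBacktrack = λ i → proj₂ (proj₂ (continue (steps i)))
      }

    walk-in-S : ∀ i → NonBacktrackingWalk.edge walk i ∈ S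
    walk-in-S i with Step.edge (steps i) ∈? S
    ... | yes e∈S = e∈S
    ... | no e∉S  = ⊥-elim (Step.used (steps i) (support _ e∉S))

  dependency⇒cycle : NoLoops E → ∀ {S} → Dependency incidence S → CycleIn E S
  dependency⇒cycle noLoops dep = walk⇒cycle walk walk-in-S
    where open DependencyWalk noLoops dep

  no-cycle⇔no-dependency : NoLoops E → ∀ S → (¬ CycleIn E S) ⇔ (¬ Dependency incidence S)
  no-cycle⇔no-dependency noLoops S = mk⇔
    (λ no-cycle dep → no-cycle (dependency⇒cycle noLoops dep))
    (λ no-dep cycle → no-dep (cycle⇒dependency cycle))

-- It sends e_a to the
-- vertex vector of an interior a and to u(a)·e₀ for a boundary a, so every
-- Dirichlet vector is a nonzero multiple of the β-image of an incidence
-- vector of Γ̂; and β is injective on vectors with coordinate sum 0.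
module TwoTerminal {n : ℕ} (B : Subset n) (u : Fin n → ℚ) (b₁ b₂ : Fin n)
                   (b₁∈B : b₁ ∈ B) (b₂∈B : b₂ ∈ B)
                   (boundary : ∀ v → v ∈ B → v ≡ b₁ ⊎ v ≡ b₂)
                   (u₁≢u₂ : u b₁ ≢ u b₂) where

  b₁≢b₂ : b₁ ≢ b₂
  b₁≢b₂ b₁≡b₂ = u₁≢u₂ (cong u b₁≡b₂)

  ∉B⇒≢ : ∀ {a b} → a ∉ B → b ∈ B → a ≢ b
  ∉B⇒≢ a∉B b∈B refl = a∉B b∈B

  -- case split on membership in B that leaves `interior` unevaluated
  boundary-or-interior : ∀ v → v ∈ B ⊎ v ∉ B
  boundary-or-interior v with v ∈? B
  ... | yes v∈B = inj₁ v∈B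
  ... | no v∉B  = inj₂ v∉B

  interior : Fin n → ℚ
  interior v with v ∈? B
  ... | yes _ = 0ℚ
  ... | no _  = 1ℚ

  interior-scales-boundary : ∀ v x → v ∈ B → interior v * x ≡ 0ℚ
  interior-scales-boundary v x v∈B with v ∈? B
  ... | yes _   = ℚP.*-zeroˡ x
  ... | no v∉B  = ⊥-elim (v∉B v∈B)

  interior-scales-interior : ∀ v x → v ∉ B → interior v * x ≡ x
  interior-scales-interior v x v∉B with v ∈? B
  ... | yes v∈B = ⊥-elim (v∉B v∈B)
  ... | no _    = ℚP.*-identityˡ x

  β : (Fin n → ℚ) → Fin (suc n) → ℚ
  β w zero    = u b₁ * w b₁ + u b₂ * w b₂
  β w (suc v) = interior v * w v

  β-linear : ∀ {k} (c : Fin k → ℚ) (v : Fin k → Fin n → ℚ) x →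
             β (lincomb c v) x ≡ Σℚ k (λ g → c g * β (v g) x)
  β-linear {k} c v zero = begin
    u b₁ * lincomb c v b₁ + u b₂ * lincomb c v b₂
      ≡⟨ sym (cong₂ _+_ (Σ-* k (u b₁) (λ g → c g * v g b₁)) (Σ-* k (u b₂) (λ g → c g * v g b₂))) ⟩
    Σℚ k (λ g → u b₁ * (c g * v g b₁)) + Σℚ k (λ g → u b₂ * (c g * v g b₂))
      ≡⟨ sym (Σ-+ k _ _) ⟩
    Σℚ k (λ g → u b₁ * (c g * v g b₁) + u b₂ * (c g * v g b₂))
      ≡⟨ Σ-cong k (λ g → solve 5 (λ a b c x y → a :* (c :* x) :+ b :* (c :* y) := c :* (a :* x :+ b :* y))
                                 refl (u b₁) (u b₂) (c g) (v g b₁) (v g b₂)) ⟩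
    Σℚ k (λ g → c g * β (v g) zero) ∎
  β-linear {k} c v (suc y) = begin
    interior y * lincomb c v y                     ≡⟨ sym (Σ-* k (interior y) (λ g → c g * v g y)) ⟩
    Σℚ k (λ g → interior y * (c g * v g y))        ≡⟨ Σ-cong k (λ g → solve 3 (λ i c x → i :* (c :* x) := c :* (i :* x))
                                                                          refl (interior y) (c g) (v g y)) ⟩
    Σℚ k (λ g → c g * β (v g) (suc y))             ∎

  βmap : LinearMap n (suc n)
  βmap = record
    { apply      = β
    ; apply-cong = λ { w≡w′ zero → cong₂ _+_ (cong (u b₁ *_) (w≡w′ b₁)) (cong (u b₂ *_) (w≡w′ b₂))
                     ; w≡w′ (suc v) → cong (interior v *_) (w≡w′ v) }
    ; linear     = β-linear
    }

  β-difference : ∀ (w w′ : Fin n → ℚ) x → β (λ y → w y - w′ y) x ≡ β w x - β w′ x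
  β-difference w w′ zero = solve 6 (λ a b x x′ y y′ → a :* (x :- x′) :+ b :* (y :- y′) := (a :* x :+ b :* y) :- (a :* x′ :+ b :* y′))
                              refl (u b₁) (u b₂) (w b₁) (w′ b₁) (w b₂) (w′ b₂)
  β-difference w w′ (suc v) = solve 3 (λ i x x′ → i :* (x :- x′) := i :* x :- i :* x′) refl (interior v) (w v) (w′ v)

  β-basis-interior : ∀ a → a ∉ B → ∀ x → β (basis a) x ≡ vtx a x
  β-basis-interior a a∉B zero = begin
    u b₁ * basis a b₁ + u b₂ * basis a b₂ ≡⟨ cong₂ (λ p q → u b₁ * p + u b₂ * q)
                                                (basis-diff a b₁ (∉B⇒≢ a∉B b₁∈B)) (basis-diff a b₂ (∉B⇒≢ a∉B b₂∈B)) ⟩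
    u b₁ * 0ℚ + u b₂ * 0ℚ                 ≡⟨ solve 2 (λ a b → a :* con 0ℚ :+ b :* con 0ℚ := con 0ℚ) refl (u b₁) (u b₂) ⟩
    0ℚ                                    ∎
  β-basis-interior a a∉B (suc v) with boundary-or-interior v
  ... | inj₁ v∈B = trans (interior-scales-boundary v _ v∈B)
                        (sym (trans (basis-suc a v) (basis-diff a v (∉B⇒≢ a∉B v∈B))))
  ... | inj₂ v∉B = trans (interior-scales-interior v _ v∉B) (sym (basis-suc a v))

  β-basis-boundary : ∀ a → a ∈ B → ∀ x → β (basis a) x ≡ (u a · e₀vec) x
  β-basis-boundary a a∈B zero with boundary a a∈B
  ... | inj₁ refl = begin
    u b₁ * basis b₁ b₁ + u b₂ * basis b₁ b₂ ≡⟨ cong₂ (λ p q → u b₁ * p + u b₂ * q) (basis-same b₁) (basis-diff b₁ b₂ b₁≢b₂) ⟩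
    u b₁ * 1ℚ + u b₂ * 0ℚ                   ≡⟨ solve 2 (λ a b → a :* con 1ℚ :+ b :* con 0ℚ := a :* con 1ℚ) refl (u b₁) (u b₂) ⟩
    u b₁ * 1ℚ                               ∎
  ... | inj₂ refl = begin
    u b₁ * basis b₂ b₁ + u b₂ * basis b₂ b₂ ≡⟨ cong₂ (λ p q → u b₁ * p + u b₂ * q)
                                                  (basis-diff b₂ b₁ (λ b₂≡b₁ → b₁≢b₂ (sym b₂≡b₁))) (basis-same b₂) ⟩
    u b₁ * 0ℚ + u b₂ * 1ℚ                   ≡⟨ solve 2 (λ a b → a :* con 0ℚ :+ b :* con 1ℚ := b :* con 1ℚ) refl (u b₁) (u b₂) ⟩
    u b₂ * 1ℚ                               ∎
  β-basis-boundary a a∈B (suc v) =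
    trans (boundary-basis-inside v) (sym (ℚP.*-zeroʳ (u a)))
    where
      boundary-basis-inside : ∀ v → interior v * basis a v ≡ 0ℚ
      boundary-basis-inside v with boundary-or-interior v
      ... | inj₁ v∈B = interior-scales-boundary v _ v∈B
      ... | inj₂ v∉B = trans (interior-scales-interior v _ v∉B)
                            (basis-diff a v (λ a≡v → v∉B (subst (_∈ B) a≡v a∈B)))

  edgeSign : Fin n → ℚ
  edgeSign i with i ∈? B
  ... | yes _ = - 1ℚ
  ... | no _  = 1ℚ

  edgeSign≢0 : ∀ i → edgeSign i ≢ 0ℚ
  edgeSign≢0 i with i ∈? B
  ... | yes _ = λ ()
  ... | no _  = λ ()

  edge-representation : ∀ i j → ¬ (i ∈ B × j ∈ B) → ∀ x →
                        edgeVec B u (i , j) x ≡ edgeSign i * β (λ y → basis i y - basis j y) x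
  edge-representation i j not-both x
    rewrite β-difference (basis i) (basis j) x
    with i ∈? B | j ∈? B
  ... | yes i∈B | yes j∈B = ⊥-elim (not-both (i∈B , j∈B))
  ... | no i∉B  | no j∉B  = sym (trans (ℚP.*-identityˡ _)
        (cong₂ _-_ (β-basis-interior i i∉B x) (β-basis-interior j j∉B x)))
  ... | no i∉B  | yes j∈B = sym (trans (ℚP.*-identityˡ _)
        (cong₂ _-_ (β-basis-interior i i∉B x) (β-basis-boundary j j∈B x)))
  ... | yes i∈B | no j∉B  = sym (trans
        (cong (- 1ℚ *_) (cong₂ _-_ (β-basis-boundary i i∈B x) (β-basis-interior j j∉B x)))
        (solve 2 (λ p q → (:- con 1ℚ) :* (p :- q) := q :- p) refl ((u i · e₀vec) x) (vtx j x)))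

  -- the scale (u b₁ − u b₂)⁻¹ turns β(e_{b₁} − e_{b₂}) into e₀
  u₁-u₂≢0 : u b₁ - u b₂ ≢ 0ℚ
  u₁-u₂≢0 = ≢⇒difference≢0 (u b₁) (u b₂) u₁≢u₂

  e₀-scale : ℚ
  e₀-scale = inv (u b₁ - u b₂) u₁-u₂≢0

  e₀-representation : ∀ x → e₀vec x ≡ e₀-scale * β (λ y → basis b₁ y - basis b₂ y) x
  e₀-representation x = sym (begin
    e₀-scale * β (λ y → basis b₁ y - basis b₂ y) x
      ≡⟨ cong (e₀-scale *_) (trans (β-difference (basis b₁) (basis b₂) x)
                                   (cong₂ _-_ (β-basis-boundary b₁ b₁∈B x) (β-basis-boundary b₂ b₂∈B x))) ⟩
    e₀-scale * (u b₁ * e₀vec x - u b₂ * e₀vec x)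
      ≡⟨ solve 4 (λ s a b e → s :* (a :* e :- b :* e) := (s :* (a :- b)) :* e) refl e₀-scale (u b₁) (u b₂) (e₀vec x) ⟩
    (e₀-scale * (u b₁ - u b₂)) * e₀vec x
      ≡⟨ cong (_* e₀vec x) (inv-inverseˡ (u b₁ - u b₂) u₁-u₂≢0) ⟩
    1ℚ * e₀vec x
      ≡⟨ ℚP.*-identityˡ (e₀vec x) ⟩
    e₀vec x ∎)

  -- β is injective on vectors with coordinate sum 0: such a w in the
  -- kernel vanishes at interior vertices, so w(b₁) + w(b₂) = 0 and
  -- u(b₁) w(b₁) + u(b₂) w(b₂) = 0, whence w(b₁) = w(b₂) = 0.
  β-injective-on-sum-zero : ∀ w → Σℚ n w ≡ 0ℚ → (∀ x → β w x ≡ 0ℚ) → ∀ y → w y ≡ 0ℚ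
  β-injective-on-sum-zero w Σw≡0 βw≡0 = w≡0
    where
      vanishes-inside : ∀ v → v ∉ B → w v ≡ 0ℚ
      vanishes-inside v v∉B = trans (sym (interior-scales-interior v (w v) v∉B)) (βw≡0 (suc v))

      supported-on-boundary : ∀ y → w y ≡ basis b₁ y * w b₁ + basis b₂ y * w b₂
      supported-on-boundary y with boundary-or-interior y
      ... | inj₂ y∉B = begin
        w y                                   ≡⟨ vanishes-inside y y∉B ⟩
        0ℚ                                    ≡⟨ solve 2 (λ p q → con 0ℚ := con 0ℚ :* p :+ con 0ℚ :* q) refl (w b₁) (w b₂) ⟩
        0ℚ * w b₁ + 0ℚ * w b₂                 ≡⟨ sym (cong₂ (λ p q → p * w b₁ + q * w b₂)
                                                   (basis-diff b₁ y (λ b₁≡y → y∉B (subst (_∈ B) b₁≡y b₁∈B)))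
                                                   (basis-diff b₂ y (λ b₂≡y → y∉B (subst (_∈ B) b₂≡y b₂∈B)))) ⟩
        basis b₁ y * w b₁ + basis b₂ y * w b₂ ∎
      ... | inj₁ y∈B with boundary y y∈B
      ...   | inj₁ refl = sym (trans (cong₂ (λ p q → p * w b₁ + q * w b₂) (basis-same b₁) (basis-diff b₂ b₁ (λ e → b₁≢b₂ (sym e))))
                                     (solve 2 (λ p q → con 1ℚ :* p :+ con 0ℚ :* q := p) refl (w b₁) (w b₂)))
      ...   | inj₂ refl = sym (trans (cong₂ (λ p q → p * w b₁ + q * w b₂) (basis-diff b₁ b₂ b₁≢b₂) (basis-same b₂))
                                     (solve 2 (λ p q → con 0ℚ :* p :+ con 1ℚ :* q := q) refl (w b₁) (w b₂)))

      boundary-sum : w b₁ + w b₂ ≡ 0ℚ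
      boundary-sum = begin
        w b₁ + w b₂
          ≡⟨ sym (cong₂ _+_ (Σ-pick n b₁ (λ _ → w b₁)) (Σ-pick n b₂ (λ _ → w b₂))) ⟩
        Σℚ n (λ y → basis b₁ y * w b₁) + Σℚ n (λ y → basis b₂ y * w b₂)
          ≡⟨ sym (Σ-+ n _ _) ⟩
        Σℚ n (λ y → basis b₁ y * w b₁ + basis b₂ y * w b₂)
          ≡⟨ sym (Σ-cong n supported-on-boundary) ⟩
        Σℚ n w
          ≡⟨ Σw≡0 ⟩
        0ℚ ∎

      boundary-zero : w b₁ ≡ 0ℚ × w b₂ ≡ 0ℚ
      boundary-zero = two-equations (u b₁) (u b₂) (w b₁) (w b₂) u₁≢u₂ (βw≡0 zero) boundary-sum

      w≡0 : ∀ y → w y ≡ 0ℚ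
      w≡0 y = begin
        w y                                   ≡⟨ supported-on-boundary y ⟩
        basis b₁ y * w b₁ + basis b₂ y * w b₂ ≡⟨ cong₂ (λ p q → basis b₁ y * p + basis b₂ y * q)
                                                   (proj₁ boundary-zero) (proj₂ boundary-zero) ⟩
        basis b₁ y * 0ℚ + basis b₂ y * 0ℚ     ≡⟨ solve 2 (λ p q → p :* con 0ℚ :+ q :* con 0ℚ := con 0ℚ) refl
                                                   (basis b₁ y) (basis b₂ y) ⟩
        0ℚ                                    ∎

module TwoTerminalNetwork {n m : ℕ} (ends : Ends n m) (B : Subset n) (net : IsNetwork ends B)
                          (∣B∣≡2 : ∣ B ∣ ≡ 2) (u : Fin n → ℚ) (u-injective : InjectiveOn B u)
                          (b₁ b₂ : Fin n) (b₁≢b₂ : b₁ ≢ b₂) (b₁∈B : b₁ ∈ B) (b₂∈B : b₂ ∈ B) where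

  Γ̂ : Ends n (suc m)
  Γ̂ = addEdge ends b₁ b₂

  open Graph Γ̂
  open TwoTerminal B u b₁ b₂ b₁∈B b₂∈B (members-of-pair ∣B∣≡2 b₁≢b₂ b₁∈B b₂∈B)
                   (λ u₁≡u₂ → b₁≢b₂ (u-injective b₁ b₂ b₁∈B b₂∈B u₁≡u₂))
    hiding (b₁≢b₂)

  noLoops-Γ̂ : NoLoops Γ̂
  noLoops-Γ̂ zero    = b₁≢b₂
  noLoops-Γ̂ (suc e) = IsSimpleConnected.noLoops (IsNetwork.graph net) e

  scale : Fin (suc m) → ℚ
  scale zero    = e₀-scale
  scale (suc e) = edgeSign (proj₁ (ends e))

  scale≢0 : ∀ g → scale g ≢ 0ℚ
  scale≢0 zero    = inv≢0 (u b₁ - u b₂) u₁-u₂≢0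
  scale≢0 (suc e) = edgeSign≢0 (proj₁ (ends e))

  dirichlet-representation : ∀ g x → dirichletVec ends B u g x ≡ scale g * β (incidence g) x
  dirichlet-representation zero    x = e₀-representation x
  dirichlet-representation (suc e) x =
    edge-representation (proj₁ (ends e)) (proj₂ (ends e)) (IsNetwork.nonAdjacentB net e) x

  β-faithful : ∀ c → (∀ x → β (lincomb c incidence) x ≡ 0ℚ) → ∀ y → lincomb c incidence y ≡ 0ℚ
  β-faithful c = β-injective-on-sum-zero (lincomb c incidence) (lincomb-incidence-sum c)

  open Transfer incidence (dirichletVec ends B u) βmap scale scale≢0 dirichlet-representation β-faithful

  dirichlet⇔graphic : ∀ S → DirichletIndep ends B u S ⇔ GraphicIndep Γ̂ S
  dirichlet⇔graphic S =
    ⇔.sym (no-cycle⇔no-dependency noLoops-Γ̂ S)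
      ⇔-∘ (no-dependency⇔ ⇔-∘ indep⇔no-dependency (dirichletVec ends B u) S)

-- M(N) ≅ M(Γ̂) via the identity on {e₀} ∪ E (e₀ ↦ the new edge), whose
-- image map fixes every subset.
proposition2p22 : {n m : ℕ} (ends : Ends n m) (B : Subset n) →
    IsNetwork ends B → ∣ B ∣ ≡ 2 →
    (u : Fin n → ℚ) → InjectiveOn B u →
    (b₁ b₂ : Fin n) → b₁ ≢ b₂ → b₁ ∈ B → b₂ ∈ B →
    MatroidIso (DirichletIndep ends B u) (GraphicIndep (addEdge ends b₁ b₂))
proposition2p22 {m = m} ends B net ∣B∣≡2 u u-injective b₁ b₂ b₁≢b₂ b₁∈B b₂∈B =
  ↔-id (Fin (suc m)) , λ S →
    (λ indep → subst (GraphicIndep Γ̂) (sym (tabulate∘lookup S)) (Equivalence.to (dirichlet⇔graphic S) indep)) ,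
    (λ acyclic → Equivalence.from (dirichlet⇔graphic S) (subst (GraphicIndep Γ̂) (tabulate∘lookup S) acyclic))
  where open TwoTerminalNetwork ends B net ∣B∣≡2 u u-injective b₁ b₂ b₁≢b₂ b₁∈B b₂∈B
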